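{- Let $G=(V,E)$ be a finite simple undirected loop-free graph and let $A\subseteq V$ be such that $d_x\ge d_y$ whenever $x\in A$ and $y\in V\setminus A$. If $\sum_{x\in A} d_x<|E|$ and $B$ is a vertex cover of $G$, then $|B|>|A|$.
   Context: $d_x$ denotes the degree of vertex $x$ in $G$. A vertex cover is a set of vertices containing at least one endpoint of every edge. -}

module Defs where

open import Data.Nat using (ℕ; _+_; _<_; _*_; _<ᵇ_)
open import Data.Sum using (_⊎_)
open import Data.Bool using (Bool; true; false; if_then_else_; _∧_)
open import Data.Fin using (Fin; toℕ)
open import Data.Fin.Subset using (Subset; _∈_; _∉_)
open import Data.Vec using (lookup)
open import Data.List using (List; map)
open import Data.Nat.ListAction using (sum)
open import Data.List.Base using (allFin)
open import Relation.Nullary using (¬_)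
open import Relation.Binary.PropositionalEquality using (_≡_)

record Graph (n : ℕ) : Set where
  field
    adj   : Fin n → Fin n → Bool
    sym   : ∀ x y → adj x y ≡ adj y x
    irref : ∀ x → adj x x ≡ false

open Graph public

ind : Bool → ℕ
ind b = if b then 1 else 0

Σv : {n : ℕ} → (Fin n → ℕ) → ℕ
Σv {n} f = sum (map f (allFin n))

deg : {n : ℕ} → Graph n → Fin n → ℕ
deg G x = Σv (λ y → ind (adj G x y))

numEdges : {n : ℕ} → Graph n → ℕ
numEdges G = Σv (λ x → Σv (λ y → ind ((toℕ x <ᵇ toℕ y) ∧ adj G x y)))

degSum : {n : ℕ} → Graph n → Subset n → ℕ
degSum G A = Σv (λ x → ind (lookup A x) * deg G x)

IsVertexCover : {n : ℕ} → Graph n → Subset n → Set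
IsVertexCover G B = ∀ x y → adj G x y ≡ true → (x ∈ B) ⊎ (y ∈ B)

module Submission where

-- Every edge has an endpoint in the cover B, so |E| ≤ Σ_{x∈B} d_x. Since A consists of vertices of
-- largest degree, there is a threshold t with d_x ≥ t on A and d_y ≤ t off A; hence exchanging the
-- vertices of B ∖ A for those of A ∖ B shows Σ_{x∈B} d_x ≤ Σ_{x∈A} d_x whenever |B| ≤ |A|, and then
-- |E| ≤ Σ_{x∈A} d_x < |E|.

open import Defs
open import Data.Nat using (ℕ; _<_; _≥_; _>_)
open import Data.Fin using (Fin)
open import Data.Fin.Subset using (Subset; _∈_; _∉_; ∣_∣)

open import Algebra.Properties.CommutativeSemigroup using (interchange)
open import Data.Bool using (Bool; true; false; _∧_; T)
open import Data.Bool.Properties using (∧-zeroʳ; ∧-identityʳ)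
open import Data.Empty using (⊥-elim)
open import Data.Fin as Fin using (toℕ)
open import Data.Fin.Subset.Properties using (_∈?_)
open import Data.List using (List; []; _∷_; map; allFin)
open import Data.List.Extrema.Nat using (max; xs≤max; max≤v⁺)
open import Data.List.Membership.Propositional.Properties using (∈-allFin)
open import Data.List.Properties using (map-cong; map-tabulate)
import Data.List.Relation.Unary.All as All
open import Data.List.Relation.Unary.All.Properties as All using ()
open import Data.Nat using (suc; _+_; _*_; _≤_; z≤n; s≤s; _<ᵇ_)
open import Data.Nat.ListAction using (sum)
open import Data.Nat.Properties
open import Data.Product using (∃-syntax; _×_; _,_)
open import Data.Sum using (inj₁; inj₂)
open import Data.Unit using (tt)
open import Data.Vec using ([]; _∷_; lookup)
open import Data.Vec.Properties using ([]=⇒lookup; lookup⇒[]=)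
open import Function using (_∘_; id)
open import Relation.Nullary using (yes; no)
open import Relation.Binary.PropositionalEquality as ≡ hiding (sym)

private
  variable
    n : ℕ
    X Y : Set

sum-map-+ : (xs : List X) (f g : X → ℕ) →
            sum (map (λ x → f x + g x) xs) ≡ sum (map f xs) + sum (map g xs)
sum-map-+ []       f g = refl
sum-map-+ (x ∷ xs) f g =
  trans (cong (f x + g x +_) (sum-map-+ xs f g))
        (interchange +-commutativeSemigroup (f x) (g x) _ _)

sum-map-*ˡ : (xs : List X) (c : ℕ) (f : X → ℕ) →
             sum (map (λ x → c * f x) xs) ≡ c * sum (map f xs)
sum-map-*ˡ []       c f = ≡.sym (*-zeroʳ c)
sum-map-*ˡ (x ∷ xs) c f =
  trans (cong (c * f x +_) (sum-map-*ˡ xs c f)) (≡.sym (*-distribˡ-+ c (f x) _))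

sum-map-mono : (xs : List X) {f g : X → ℕ} → (∀ x → f x ≤ g x) →
               sum (map f xs) ≤ sum (map g xs)
sum-map-mono []       f≤g = z≤n
sum-map-mono (x ∷ xs) f≤g = +-mono-≤ (f≤g x) (sum-map-mono xs f≤g)

sum-map-zero : (xs : List X) → sum (map (λ _ → 0) xs) ≡ 0
sum-map-zero []       = refl
sum-map-zero (x ∷ xs) = sum-map-zero xs

sum-map-swap : (xs : List X) (ys : List Y) (h : X → Y → ℕ) →
               sum (map (λ x → sum (map (h x) ys)) xs) ≡
               sum (map (λ y → sum (map (λ x → h x y) xs)) ys)
sum-map-swap []       ys h = ≡.sym (sum-map-zero ys)
sum-map-swap (x ∷ xs) ys h =
  trans (cong (sum (map (h x) ys) +_) (sum-map-swap xs ys h))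
        (≡.sym (sum-map-+ ys (h x) (λ y → sum (map (λ x → h x y) xs))))

sum-map-symmetrize : {X : Set} (xs : List X) (h : X → X → ℕ) →
  sum (map (λ x → sum (map (λ y → h x y + h y x) xs)) xs) ≡
  2 * sum (map (λ x → sum (map (h x) xs)) xs)
sum-map-symmetrize {X} xs h = begin
  sum (map (λ x → sum (map (λ y → h x y + h y x) xs)) xs)
    ≡⟨ cong sum (map-cong (λ x → sum-map-+ xs (h x) (λ y → h y x)) xs) ⟩
  sum (map (λ x → Σh x + sum (map (λ y → h y x) xs)) xs)
    ≡⟨ sum-map-+ xs Σh _ ⟩
  ΣΣh + sum (map (λ x → sum (map (λ y → h y x) xs)) xs)
    ≡⟨ cong (ΣΣh +_) (sum-map-swap xs xs (λ y x → h x y)) ⟩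
  ΣΣh + ΣΣh
    ≡⟨ cong (ΣΣh +_) (≡.sym (+-identityʳ ΣΣh)) ⟩
  2 * ΣΣh ∎
  where
  open ≡-Reasoning
  Σh : X → ℕ
  Σh x = sum (map (h x) xs)
  ΣΣh : ℕ
  ΣΣh = sum (map Σh xs)

weight : (Fin n → ℕ) → Subset n → ℕ
weight w A = Σv (λ x → ind (lookup A x) * w x)

Σv-suc : (f : Fin (suc n) → ℕ) → Σv f ≡ f Fin.zero + Σv (f ∘ Fin.suc)
Σv-suc f = cong (f Fin.zero +_) (cong sum
  (trans (map-tabulate Fin.suc f) (≡.sym (map-tabulate id (f ∘ Fin.suc)))))

∣p∣≡Σv-ind : (p : Subset n) → ∣ p ∣ ≡ Σv (ind ∘ lookup p)
∣p∣≡Σv-ind []          = refl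
∣p∣≡Σv-ind (true ∷ p)  = trans (cong suc (∣p∣≡Σv-ind p)) (≡.sym (Σv-suc (ind ∘ lookup (true ∷ p))))
∣p∣≡Σv-ind (false ∷ p) = trans (∣p∣≡Σv-ind p) (≡.sym (Σv-suc (ind ∘ lookup (false ∷ p))))

lookup≡false⇒∉ : {x : Fin n} {p : Subset n} → lookup p x ≡ false → x ∉ p
lookup≡false⇒∉ eq x∈p with () ← trans (≡.sym ([]=⇒lookup x∈p)) eq

exchange-ind : (a b : Bool) {d t : ℕ} → (a ≡ true → t ≤ d) → (a ≡ false → d ≤ t) →
               ind b * d + t * ind a ≤ ind a * d + t * ind b
exchange-ind true  true  t≤d d≤t = ≤-refl
exchange-ind false false t≤d d≤t = ≤-refl
exchange-ind true  false {d} {t} t≤d d≤t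
  rewrite *-identityʳ t | *-zeroʳ t | +-identityʳ d | +-identityʳ d = t≤d refl
exchange-ind false true  {d} {t} t≤d d≤t
  rewrite *-identityʳ t | *-zeroʳ t | +-identityʳ d | +-identityʳ d = d≤t refl

-- Adding t * |A| to both sides turns the exchange into a vertexwise inequality.
weight-exchange : (w : Fin n → ℕ) (t : ℕ) (A B : Subset n) →
                  (∀ x → x ∈ A → t ≤ w x) → (∀ y → y ∉ A → w y ≤ t) →
                  ∣ B ∣ ≤ ∣ A ∣ → weight w B ≤ weight w A
weight-exchange {n} w t A B above below ∣B∣≤∣A∣ =
  +-cancelʳ-≤ (t * ∣A∣) _ _ (begin
    weight w B + t * ∣A∣   ≤⟨ summed ⟩
    weight w A + t * ∣B∣   ≤⟨ +-monoʳ-≤ (weight w A) (*-monoʳ-≤ t ∣B∣≤∣A∣′) ⟩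
    weight w A + t * ∣A∣   ∎)
  where
  open ≤-Reasoning
  xs = allFin n
  a b : Fin n → ℕ
  a = ind ∘ lookup A
  b = ind ∘ lookup B
  ∣A∣ ∣B∣ : ℕ
  ∣A∣ = Σv a
  ∣B∣ = Σv b
  ∣B∣≤∣A∣′ : ∣B∣ ≤ ∣A∣
  ∣B∣≤∣A∣′ = subst₂ _≤_ (∣p∣≡Σv-ind B) (∣p∣≡Σv-ind A) ∣B∣≤∣A∣
  pointwise : ∀ x → b x * w x + t * a x ≤ a x * w x + t * b x
  pointwise x = exchange-ind (lookup A x) (lookup B x)
    (above x ∘ lookup⇒[]= x A) (below x ∘ lookup≡false⇒∉)
  summed : weight w B + t * ∣A∣ ≤ weight w A + t * ∣B∣
  summed = subst₂ _≤_
    (trans (sum-map-+ xs _ _) (cong (weight w B +_) (sum-map-*ˡ xs t a)))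
    (trans (sum-map-+ xs _ _) (cong (weight w A +_) (sum-map-*ˡ xs t b)))
    (sum-map-mono xs pointwise)

separating-threshold : (w : Fin n → ℕ) (A : Subset n) →
                       (∀ x y → x ∈ A → y ∉ A → w x ≥ w y) →
                       ∃[ t ] (∀ x → x ∈ A → t ≤ w x) × (∀ y → y ∉ A → w y ≤ t)
separating-threshold {n} w A top = max 0 (map outside xs) , above , below
  where
  xs = allFin n
  outside : Fin n → ℕ
  outside y with y ∈? A
  ... | yes _ = 0
  ... | no  _ = w y
  above : ∀ x → x ∈ A → max 0 (map outside xs) ≤ w x
  above x x∈A = max≤v⁺ z≤n (All.map⁺ {xs = xs} (All.tabulate (λ {y} _ → outside≤ y)))
    where
    outside≤ : ∀ y → outside y ≤ w x
    outside≤ y with y ∈? A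
    ... | yes _   = z≤n
    ... | no  y∉A = top x y x∈A y∉A
  below : ∀ y → y ∉ A → w y ≤ max 0 (map outside xs)
  below y y∉A with y ∈? A | All.lookup (All.map⁻ (xs≤max 0 (map outside xs))) (∈-allFin y)
  ... | yes y∈A | _ = ⊥-elim (y∉A y∈A)
  ... | no  _   | le = le

top-weight-subset-maximal : (w : Fin n → ℕ) (A : Subset n) →
                            (∀ x y → x ∈ A → y ∉ A → w x ≥ w y) →
                            (B : Subset n) → ∣ B ∣ ≤ ∣ A ∣ → weight w B ≤ weight w A
top-weight-subset-maximal w A top B with separating-threshold w A top
... | t , above , below = weight-exchange w t A B above below

ind-<ᵇ-antisym : ∀ m k → ind (m <ᵇ k) + ind (k <ᵇ m) ≤ 1
ind-<ᵇ-antisym m k with m <ᵇ k in m<ᵇk | k <ᵇ m in k<ᵇm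
... | true  | true  = ⊥-elim (<-asym (<ᵇ⇒< m k (subst T (≡.sym m<ᵇk) tt))
                                    (<ᵇ⇒< k m (subst T (≡.sym k<ᵇm) tt)))
... | true  | false = ≤-refl
... | false | true  = ≤-refl
... | false | false = z≤n

edge-pair≤cover-pair : (c₁ c₂ b₁ b₂ e : Bool) → ind c₁ + ind c₂ ≤ 1 →
                       (e ≡ true → 1 ≤ ind b₁ + ind b₂) →
                       ind (c₁ ∧ e) + ind (c₂ ∧ e) ≤ ind b₁ * ind e + ind b₂ * ind e
edge-pair≤cover-pair c₁ c₂ b₁ b₂ false _ _
  rewrite ∧-zeroʳ c₁ | ∧-zeroʳ c₂ = z≤n
edge-pair≤cover-pair c₁ c₂ b₁ b₂ true oriented covered
  rewrite ∧-identityʳ c₁ | ∧-identityʳ c₂ | *-identityʳ (ind b₁) | *-identityʳ (ind b₂)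
  = ≤-trans oriented (covered refl)

cover-hits-edge : (G : Graph n) (B : Subset n) → IsVertexCover G B →
                  ∀ x y → adj G x y ≡ true → 1 ≤ ind (lookup B x) + ind (lookup B y)
cover-hits-edge G B cover x y xy with cover x y xy
... | inj₁ x∈B rewrite []=⇒lookup x∈B = s≤s z≤n
... | inj₂ y∈B rewrite []=⇒lookup y∈B = m≤n+m 1 (ind (lookup B x))

-- numEdges counts an edge only under its increasing orientation, so both sides are symmetrized
-- in (x, y) first; then each edge contributes 1 on the left and at least 1 on the right.
numEdges≤degSum-cover : (G : Graph n) (B : Subset n) → IsVertexCover G B →
                        numEdges G ≤ degSum G B
numEdges≤degSum-cover {n} G B cover = *-cancelˡ-≤ 2 (subst₂ _≤_
  (sum-map-symmetrize xs edge)
  (trans (sum-map-symmetrize xs incident) (cong (2 *_) incident-total))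
  (sum-map-mono xs (λ x → sum-map-mono xs (pointwise x))))
  where
  xs = allFin n
  edge incident : Fin n → Fin n → ℕ
  edge x y = ind ((toℕ x <ᵇ toℕ y) ∧ adj G x y)
  incident x y = ind (lookup B x) * ind (adj G x y)
  pointwise : ∀ x y → edge x y + edge y x ≤ incident x y + incident y x
  pointwise x y rewrite Graph.sym G y x =
    edge-pair≤cover-pair (toℕ x <ᵇ toℕ y) (toℕ y <ᵇ toℕ x) (lookup B x) (lookup B y) (adj G x y)
      (ind-<ᵇ-antisym (toℕ x) (toℕ y)) (cover-hits-edge G B cover x y)
  incident-total : sum (map (λ x → sum (map (incident x) xs)) xs) ≡ degSum G B
  incident-total = cong sum (map-cong (λ x → sum-map-*ˡ xs (ind (lookup B x)) (ind ∘ adj G x)) xs)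

proposition3p5 : (n : ℕ) (G : Graph n) (A : Subset n)
    → (∀ x y → x ∈ A → y ∉ A → deg G x ≥ deg G y)
    → degSum G A < numEdges G
    → (B : Subset n) → IsVertexCover G B
    → ∣ B ∣ > ∣ A ∣
proposition3p5 n G A top small B cover = ≰⇒> λ ∣B∣≤∣A∣ → <⇒≱ small (begin
  numEdges G   ≤⟨ numEdges≤degSum-cover G B cover ⟩
  degSum G B   ≤⟨ top-weight-subset-maximal (deg G) A top B ∣B∣≤∣A∣ ⟩
  degSum G A   ∎)
  where open ≤-Reasoning
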